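{- Let $b\ge2$ and $N\ge0$ be integers, and let $\{s_n(x)\}$ be a Sheffer polynomial sequence with associated sequence $\{p_n(x)\}$. With the matrices $S_{b,N}$, $P_{b,N}$ defined below, for variables $\mathbf{x}_{N+1}=(x_0,\dots,x_N)$ and $\mathbf{x}_N=(x_0,\dots,x_{N-1})$, \[ S_{b,N+1}(\mathbf{x}_{N+1})=S_{b,1}(x_N)\otimes S_{b,N}(\mathbf{x}_N)\quad\text{and}\quad P_{b,N+1}(\mathbf{x}_{N+1})=P_{b,1}(x_N)\otimes P_{b,N}(\mathbf{x}_N), \] where $\otimes$ denotes the Kronecker product.
   Context: Sheffer sequences: let $f(t)=\sum_{k\ge0}a_kt^k$ with $a_0=0,a_1\ne0$, $g(t)=\sum_{k\ge0}b_kt^k$ with $b_0\ne0$, $\bar f$ the compositional inverse of $f$; $s_n(x)$ is defined by $\frac{1}{g(\bar f(t))}e^{x\bar f(t)}=\sum_{n\ge0}\frac{s_n(x)}{n!}t^n$ and its associated sequence $p_n(x)$ by $e^{x\bar f(t)}=\sum_{n\ge0}\frac{p_n(x)}{n!}t^n$. Put $\bar s_k=s_k/k!$, $\bar p_k=p_k/k!$. For non-negative integers $k,j$, $k\preceq_b j$ means every base-$b$ digit of $k$ is at most the corresponding digit of $j$. Set $S_{b,0}=P_{b,0}=1$ (the $1\times1$ matrix). For $N>0$ and $\mathbf{x}_N=(x_0,\dots,x_{N-1})$, $S_{b,N}(\mathbf{x}_N)$ and $P_{b,N}(\mathbf{x}_N)$ are the $b^N\times b^N$ matrices with rows and columns indexed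 by $0,\dots,b^N-1$, whose $(j,k)$ entries are respectively $\prod_{i=0}^{N-1}\bar s_{d_i}(x_i)$ and $\prod_{i=0}^{N-1}\bar p_{d_i}(x_i)$ if $0\le k\le j\le b^N-1$ and $k\preceq_b j$, and $0$ otherwise, where $j-k=d_0b^0+\cdots+d_{N-1}b^{N-1}$ is the base-$b$ expansion of $j-k$. In particular $S_{b,1}(x)$ (resp. $P_{b,1}(x)$) is the $b\times b$ lower-triangular matrix with $(j,k)$ entry $\bar s_{j-k}(x)$ (resp. $\bar p_{j-k}(x)$) for $0\le k\le j\le b-1$ and $0$ otherwise. -}

module Defs where

open import Data.Nat as ℕ using (ℕ; zero; suc; _∸_; _≤?_; NonZero)
open import Data.Nat.Properties using (_!≢0)
open import Data.Nat.Base using (_!)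
open import Data.Fin as Fin using (Fin; toℕ; quotient; remainder)
open import Data.Fin.Properties using (all?)
open import Data.Integer using (+_)
open import Data.Rational as ℚ using (ℚ; 0ℚ; 1ℚ; _+_; _*_)
open import Relation.Nullary using (Dec; yes; no; _×-dec_)
open import Data.Product using (_×_)
open import Relation.Binary.PropositionalEquality using (_≡_)
open import Relation.Nullary using (¬_)

PowerSeries : Set
PowerSeries = ℕ → ℚ

sumTo : ℕ → (ℕ → ℚ) → ℚ
sumTo zero    F = F 0
sumTo (suc n) F = sumTo n F + F (suc n)

_⊛_ : PowerSeries → PowerSeries → PowerSeries
(F ⊛ G) n = sumTo n (λ i → F i * G (n ∸ i))

oneSeries : PowerSeries
oneSeries zero    = 1ℚ
oneSeries (suc _) = 0ℚ

tSeries : PowerSeries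
tSeries 1 = 1ℚ
tSeries _ = 0ℚ

_^ˢ_ : PowerSeries → ℕ → PowerSeries
F ^ˢ zero  = oneSeries
F ^ˢ suc m = F ⊛ (F ^ˢ m)

-- composition F(G(t)), meaningful when G 0 = 0:
-- [t^n] F(G(t)) = Σ_{k=0}^{n} F_k [t^n] G(t)^k
_∘ˢ_ : PowerSeries → PowerSeries → PowerSeries
(F ∘ˢ G) n = sumTo n (λ k → F k * (G ^ˢ k) n)

_^ℚ_ : ℚ → ℕ → ℚ
x ^ℚ zero  = 1ℚ
x ^ℚ suc m = x * (x ^ℚ m)

inv! : ℕ → ℚ
inv! m = (+ 1) ℚ./ (m !) where instance _ = m !≢0

-- Given H(t) (= 1/g(fbar(t))) and fbar, the value at x of
--   [t^n] H(t) e^{x fbar(t)}  =  Σ_{m=0}^{n} (x^m / m!) [t^n] (H(t) fbar(t)^m),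
-- i.e. s_n(x)/n! (the "bar" normalisation).
shefferBar : PowerSeries → PowerSeries → ℕ → ℚ → ℚ
shefferBar H fbar n x = sumTo n (λ m → (x ^ℚ m) * inv! m * (H ⊛ (fbar ^ˢ m)) n)

record ShefferData : Set where
  field
    f g fbar H : PowerSeries
    f₀≡0      : f 0 ≡ 0ℚ
    f₁≢0      : ¬ (f 1 ≡ 0ℚ)
    g₀≢0      : ¬ (g 0 ≡ 0ℚ)
    fbar₀≡0   : fbar 0 ≡ 0ℚ
    fbar-inv  : ∀ n → (f ∘ˢ fbar) n ≡ tSeries n
    H-inv     : ∀ n → (H ⊛ (g ∘ˢ fbar)) n ≡ oneSeries n
  -- s̄_n(x) = s_n(x)/n!
  sBar : ℕ → ℚ → ℚ
  sBar = shefferBar H fbar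
  -- p̄_n(x) = p_n(x)/n!  (associated sequence: g = 1)
  pBar : ℕ → ℚ → ℚ
  pBar = shefferBar oneSeries fbar

digit : (b : ℕ) → .{{NonZero b}} → ℕ → ℕ → ℕ
digit b zero    n = n ℕ.% b
digit b (suc i) n = digit b i (n ℕ./ b)

-- k ⪯_b j for numbers below b^N: each of the N base-b digits of k is at most
-- the corresponding digit of j (all higher digits are 0 for both).
_⪯[_,_]_ : ℕ → (b : ℕ) → .{{NonZero b}} → ℕ → ℕ → Set
k ⪯[ b , N ] j = (i : Fin N) → digit b (toℕ i) k ℕ.≤ digit b (toℕ i) j

_⪯?[_,_]_ : ∀ k b .{{_ : NonZero b}} N j → Dec (k ⪯[ b , N ] j)
k ⪯?[ b , N ] j = all? (λ i → digit b (toℕ i) k ≤? digit b (toℕ i) j)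

Mat : ℕ → Set
Mat n = Fin n → Fin n → ℚ

-- Kronecker product A ⊗ B : (m*n) × (m*n), rows/cols r = r₁ * n + r₂
infixl 7 _⊗_
_⊗_ : ∀ {m n} → Mat m → Mat n → Mat (m ℕ.* n)
_⊗_ {m} {n} A B r c =
  A (quotient n r) (quotient n c) * B (remainder {m} n r) (remainder {m} n c)

prodFin : (N : ℕ) → (Fin N → ℚ) → ℚ
prodFin zero    F = 1ℚ
prodFin (suc N) F = F Fin.zero * prodFin N (λ i → F (Fin.suc i))

ifDec : ∀ {P : Set} → Dec P → ℚ → ℚ → ℚ
ifDec (yes _) a _ = a
ifDec (no _)  _ b = b

digitMatrix : (ℕ → ℚ → ℚ) → (b : ℕ) → .{{NonZero b}} → (N : ℕ) →
              (Fin N → ℚ) → Mat (b ℕ.^ N)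
digitMatrix σ b N x j k =
  ifDec ((toℕ k ≤? toℕ j) ×-dec (toℕ k ⪯?[ b , N ] toℕ j))
        (prodFin N (λ i → σ (digit b (toℕ i) (toℕ j ∸ toℕ k)) (x i)))
        0ℚ

module _ (D : ShefferData) where
  open ShefferData D
  SMat : (b : ℕ) → .{{NonZero b}} → (N : ℕ) → (Fin N → ℚ) → Mat (b ℕ.^ N)
  SMat b N = digitMatrix sBar b N
  PMat : (b : ℕ) → .{{NonZero b}} → (N : ℕ) → (Fin N → ℚ) → Mat (b ℕ.^ N)
  PMat b N = digitMatrix pBar b N

-- The b × b matrix with (j,k) entry σ_{j-k}(x) for k ≤ j and 0 otherwise
-- (this is S_{b,1}(x) resp. P_{b,1}(x), stated as a b×b matrix).
oneDigitMatrix : (ℕ → ℚ → ℚ) → (b : ℕ) → ℚ → Mat b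
oneDigitMatrix σ b x j k = ifDec (toℕ k ≤? toℕ j) (σ (toℕ j ∸ toℕ k) x) 0ℚ

module _ (D : ShefferData) where
  open ShefferData D
  S1Mat : (b : ℕ) → ℚ → Mat b
  S1Mat = oneDigitMatrix sBar
  P1Mat : (b : ℕ) → ℚ → Mat b
  P1Mat = oneDigitMatrix pBar

{-# OPTIONS --safe #-}
-- The (j,k) entry of S_{b,N+1} only involves the base-b digits of j, k and j − k.
-- Writing j = b^N j₁ + j₂ and k = b^N k₁ + k₂ with j₁, k₁ < b and j₂, k₂ < b^N,
-- the top digit of j, k is j₁, k₁ and the lower N digits are those of j₂, k₂; when
-- k ⪯_b j there are no borrows, so j − k = b^N (j₁ − k₁) + (j₂ − k₂) splits the same
-- way.  Hence both the support condition and the digit product of the entry factor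
-- into a top part (an entry of S_{b,1}) and a lower part (an entry of S_{b,N}),
-- which is the Kronecker product.  Nothing about Sheffer sequences is used: the
-- factorisation holds for every family σ in place of s̄ or p̄, and for every b ≥ 1.
module Submission where

open import Defs
open import Algebra.Bundles using (CommutativeMonoid)
open import Data.Empty using (⊥-elim)
open import Data.Fin as Fin using (Fin; toℕ; fromℕ; inject₁; quotient; remainder)
open import Data.Fin.Properties using (toℕ<n; toℕ-combine; combine-remQuot)
open import Data.Fin.Relation.Unary.Top using (view; ‵fromℕ; ‵inject₁)
open import Data.Nat as ℕ using (ℕ; zero; suc; _≤_; _<_; _∸_; _^_; _≤?_; NonZero; z≤n; s≤s)
open import Data.Nat.DivMod using (_/_; _%_; m<n⇒m%n≡m; [m+kn]%n≡m%n; +-distrib-/-∣ʳ; m*n/n≡m; m<n*o⇒m/o<n; m≡m%n+[m/n]*n)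
open import Data.Nat.Divisibility using (n∣m*n)
open import Data.Nat.Properties
  using (+-comm; *-comm; *-assoc; +-identityʳ; *-identityˡ; +-mono-≤; *-monoʳ-≤; *-monoˡ-≤;
         ∸-+-assoc; +-∸-comm; +-∸-assoc; *-distribˡ-∸; m∸n≤m; ≤-<-trans; module ≤-Reasoning)
open import Data.Product using (_×_; _,_; proj₁; proj₂)
open import Data.Rational using (ℚ; 0ℚ; _*_)
import Data.Rational.Properties as ℚ
open import Function.Bundles using (_⇔_; mk⇔; Equivalence)
open import Relation.Nullary using (Dec; yes; no; _×-dec_)
open import Relation.Binary.PropositionalEquality using (_≡_; refl; sym; trans; cong; cong₂; subst; subst₂; module ≡-Reasoning)

open import Algebra.Properties.CommutativeSemigroup
  (CommutativeMonoid.commutativeSemigroup ℚ.*-1-commutativeMonoid) using (x∙yz≈y∙xz)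

ifDec-zero-* : ∀ {P Q R : Set} (p : Dec P) (q : Dec Q) (r : Dec R) {a c d : ℚ} →
               P ⇔ (Q × R) → (Q × R → a ≡ c * d) →
               ifDec p a 0ℚ ≡ ifDec q c 0ℚ * ifDec r d 0ℚ
ifDec-zero-* (yes _) (yes q) (yes r) _   a≡cd = a≡cd (q , r)
ifDec-zero-* (yes p) (no ¬q) _       P⇔QR _    = ⊥-elim (¬q (proj₁ (Equivalence.to P⇔QR p)))
ifDec-zero-* (yes p) (yes _) (no ¬r) P⇔QR _    = ⊥-elim (¬r (proj₂ (Equivalence.to P⇔QR p)))
ifDec-zero-* (no ¬p) (yes q) (yes r) P⇔QR _    = ⊥-elim (¬p (Equivalence.from P⇔QR (q , r)))
ifDec-zero-* (no _)  (yes _) (no _)  {c = c} _ _ = sym (ℚ.*-zeroʳ c)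
ifDec-zero-* (no _)  (no _)  r       {d = d} _ _ = sym (ℚ.*-zeroˡ (ifDec r d 0ℚ))

prodFin-cong : ∀ N {F G : Fin N → ℚ} → (∀ i → F i ≡ G i) → prodFin N F ≡ prodFin N G
prodFin-cong zero    F≗G = refl
prodFin-cong (suc N) F≗G = cong₂ _*_ (F≗G Fin.zero) (prodFin-cong N (λ i → F≗G (Fin.suc i)))

prodFin-last : ∀ N (F : Fin (suc N) → ℚ) →
               prodFin (suc N) F ≡ F (fromℕ N) * prodFin N (λ i → F (inject₁ i))
prodFin-last zero    F = refl
prodFin-last (suc N) F = begin
  F Fin.zero * prodFin (suc N) (λ i → F (Fin.suc i))
    ≡⟨ cong (F Fin.zero *_) (prodFin-last N (λ i → F (Fin.suc i))) ⟩
  F Fin.zero * (F (fromℕ (suc N)) * prodFin N (λ i → F (Fin.suc (inject₁ i))))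
    ≡⟨ x∙yz≈y∙xz (F Fin.zero) (F (fromℕ (suc N))) _ ⟩
  F (fromℕ (suc N)) * prodFin (suc N) (λ i → F (inject₁ i)) ∎
  where open ≡-Reasoning

[m*n+o]∸[m*p+q]≡m*[n∸p]+[o∸q] : ∀ m {n o p q} → p ≤ n → q ≤ o →
                               (m ℕ.* n ℕ.+ o) ∸ (m ℕ.* p ℕ.+ q) ≡ m ℕ.* (n ∸ p) ℕ.+ (o ∸ q)
[m*n+o]∸[m*p+q]≡m*[n∸p]+[o∸q] m {n} {o} {p} {q} p≤n q≤o = begin
  (m ℕ.* n ℕ.+ o) ∸ (m ℕ.* p ℕ.+ q)   ≡⟨ ∸-+-assoc (m ℕ.* n ℕ.+ o) (m ℕ.* p) q ⟨
  (m ℕ.* n ℕ.+ o) ∸ m ℕ.* p ∸ q       ≡⟨ cong (_∸ q) (+-∸-comm o (*-monoʳ-≤ m p≤n)) ⟩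
  (m ℕ.* n ∸ m ℕ.* p) ℕ.+ o ∸ q       ≡⟨ +-∸-assoc (m ℕ.* n ∸ m ℕ.* p) q≤o ⟩
  (m ℕ.* n ∸ m ℕ.* p) ℕ.+ (o ∸ q)     ≡⟨ cong (ℕ._+ (o ∸ q)) (*-distribˡ-∸ m n p) ⟨
  m ℕ.* (n ∸ p) ℕ.+ (o ∸ q) ∎
  where open ≡-Reasoning

-- digitMatrix σ b N x j k is definitionally digitEntry σ b N x (toℕ j) (toℕ k).
digitEntry : (ℕ → ℚ → ℚ) → (b : ℕ) → .{{NonZero b}} → (N : ℕ) → (Fin N → ℚ) → ℕ → ℕ → ℚ
digitEntry σ b N x j k =
  ifDec ((k ≤? j) ×-dec (k ⪯?[ b , N ] j)) (prodFin N (λ i → σ (digit b (toℕ i) (j ∸ k)) (x i))) 0ℚ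

module Digits (b : ℕ) .{{_ : NonZero b}} where

  b^[1+n]*a≡b^n*a*b : ∀ n a → b ^ suc n ℕ.* a ≡ b ^ n ℕ.* a ℕ.* b
  b^[1+n]*a≡b^n*a*b n a = trans (*-assoc b (b ^ n) a) (*-comm b (b ^ n ℕ.* a))

  [b^[1+n]*a+c]/b≡b^n*a+c/b : ∀ n a c → (b ^ suc n ℕ.* a ℕ.+ c) / b ≡ b ^ n ℕ.* a ℕ.+ c / b
  [b^[1+n]*a+c]/b≡b^n*a+c/b n a c = begin
    (b ^ suc n ℕ.* a ℕ.+ c) / b            ≡⟨ cong (_/ b) (+-comm (b ^ suc n ℕ.* a) c) ⟩
    (c ℕ.+ b ^ suc n ℕ.* a) / b            ≡⟨ cong (λ m → (c ℕ.+ m) / b) (b^[1+n]*a≡b^n*a*b n a) ⟩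
    (c ℕ.+ b ^ n ℕ.* a ℕ.* b) / b          ≡⟨ +-distrib-/-∣ʳ c (n∣m*n (b ^ n ℕ.* a)) ⟩
    c / b ℕ.+ b ^ n ℕ.* a ℕ.* b / b        ≡⟨ cong (c / b ℕ.+_) (m*n/n≡m (b ^ n ℕ.* a) b) ⟩
    c / b ℕ.+ b ^ n ℕ.* a                  ≡⟨ +-comm (c / b) (b ^ n ℕ.* a) ⟩
    b ^ n ℕ.* a ℕ.+ c / b ∎
    where open ≡-Reasoning

  /b-< : ∀ n {c} → c < b ^ suc n → c / b < b ^ n
  /b-< n {c} c<b^[1+n] = m<n*o⇒m/o<n (subst (c <_) (*-comm b (b ^ n)) c<b^[1+n])

  digit-fromℕ : ∀ n {a c} → a < b → c < b ^ n → digit b (toℕ (fromℕ n)) (b ^ n ℕ.* a ℕ.+ c) ≡ a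
  digit-fromℕ zero    {a} a<b (s≤s z≤n) = begin
    (1 ℕ.* a ℕ.+ 0) % b ≡⟨ cong (_% b) (trans (+-identityʳ (1 ℕ.* a)) (*-identityˡ a)) ⟩
    a % b               ≡⟨ m<n⇒m%n≡m a<b ⟩
    a ∎
    where open ≡-Reasoning
  digit-fromℕ (suc n) {a} {c} a<b c<b^[1+n] = begin
    digit b (toℕ (fromℕ n)) ((b ^ suc n ℕ.* a ℕ.+ c) / b)
      ≡⟨ cong (digit b (toℕ (fromℕ n))) ([b^[1+n]*a+c]/b≡b^n*a+c/b n a c) ⟩
    digit b (toℕ (fromℕ n)) (b ^ n ℕ.* a ℕ.+ c / b)
      ≡⟨ digit-fromℕ n a<b (/b-< n c<b^[1+n]) ⟩
    a ∎
    where open ≡-Reasoning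

  digit-inject₁ : ∀ {n} a c (i : Fin n) → digit b (toℕ (inject₁ i)) (b ^ n ℕ.* a ℕ.+ c) ≡ digit b (toℕ i) c
  digit-inject₁ {suc n} a c Fin.zero = begin
    (b ^ suc n ℕ.* a ℕ.+ c) % b      ≡⟨ cong (λ m → (m ℕ.+ c) % b) (b^[1+n]*a≡b^n*a*b n a) ⟩
    (b ^ n ℕ.* a ℕ.* b ℕ.+ c) % b    ≡⟨ cong (_% b) (+-comm (b ^ n ℕ.* a ℕ.* b) c) ⟩
    (c ℕ.+ b ^ n ℕ.* a ℕ.* b) % b    ≡⟨ [m+kn]%n≡m%n c (b ^ n ℕ.* a) b ⟩
    c % b ∎
    where open ≡-Reasoning
  digit-inject₁ {suc n} a c (Fin.suc i) = begin
    digit b (toℕ (inject₁ i)) ((b ^ suc n ℕ.* a ℕ.+ c) / b)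
      ≡⟨ cong (digit b (toℕ (inject₁ i))) ([b^[1+n]*a+c]/b≡b^n*a+c/b n a c) ⟩
    digit b (toℕ (inject₁ i)) (b ^ n ℕ.* a ℕ.+ c / b)
      ≡⟨ digit-inject₁ a (c / b) i ⟩
    digit b (toℕ i) (c / b) ∎
    where open ≡-Reasoning

  ⪯⇒≤ : ∀ n {k j} → k < b ^ n → k ⪯[ b , n ] j → k ≤ j
  ⪯⇒≤ zero    (s≤s z≤n) _ = z≤n
  ⪯⇒≤ (suc n) {k} {j} k<b^[1+n] k⪯j = begin
    k                       ≡⟨ m≡m%n+[m/n]*n k b ⟩
    k % b ℕ.+ (k / b) ℕ.* b  ≤⟨ +-mono-≤ (k⪯j Fin.zero) (*-monoˡ-≤ b k/b≤j/b) ⟩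
    j % b ℕ.+ (j / b) ℕ.* b  ≡⟨ m≡m%n+[m/n]*n j b ⟨
    j ∎
    where
    open ≤-Reasoning
    k/b≤j/b : k / b ≤ j / b
    k/b≤j/b = ⪯⇒≤ n (/b-< n k<b^[1+n]) (λ i → k⪯j (Fin.suc i))

  ⪯-split : ∀ n {j₁ k₁ j₂ k₂} → j₁ < b → k₁ < b → j₂ < b ^ n → k₂ < b ^ n →
            (b ^ n ℕ.* k₁ ℕ.+ k₂) ⪯[ b , suc n ] (b ^ n ℕ.* j₁ ℕ.+ j₂) ⇔ (k₁ ≤ j₁ × k₂ ⪯[ b , n ] j₂)
  ⪯-split n {j₁} {k₁} {j₂} {k₂} j₁<b k₁<b j₂<b^n k₂<b^n = mk⇔ to from
    where
    to : (b ^ n ℕ.* k₁ ℕ.+ k₂) ⪯[ b , suc n ] (b ^ n ℕ.* j₁ ℕ.+ j₂) → k₁ ≤ j₁ × k₂ ⪯[ b , n ] j₂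
    to k⪯j = subst₂ _≤_ (digit-fromℕ n k₁<b k₂<b^n) (digit-fromℕ n j₁<b j₂<b^n) (k⪯j (fromℕ n))
           , λ i → subst₂ _≤_ (digit-inject₁ k₁ k₂ i) (digit-inject₁ j₁ j₂ i) (k⪯j (inject₁ i))
    from : k₁ ≤ j₁ × k₂ ⪯[ b , n ] j₂ → (b ^ n ℕ.* k₁ ℕ.+ k₂) ⪯[ b , suc n ] (b ^ n ℕ.* j₁ ℕ.+ j₂)
    from (k₁≤j₁ , k₂⪯j₂) i with view i
    ... | ‵fromℕ     = subst₂ _≤_ (sym (digit-fromℕ n k₁<b k₂<b^n)) (sym (digit-fromℕ n j₁<b j₂<b^n)) k₁≤j₁
    ... | ‵inject₁ i = subst₂ _≤_ (sym (digit-inject₁ k₁ k₂ i)) (sym (digit-inject₁ j₁ j₂ i)) (k₂⪯j₂ i)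

  module _ (N : ℕ) {j₁ k₁ j₂ k₂ : ℕ} (j₁<b : j₁ < b) (k₁<b : k₁ < b) (j₂<b^N : j₂ < b ^ N) (k₂<b^N : k₂ < b ^ N) where

    private
      j k : ℕ
      j = b ^ N ℕ.* j₁ ℕ.+ j₂
      k = b ^ N ℕ.* k₁ ℕ.+ k₂

    support-split : (k ≤ j × k ⪯[ b , suc N ] j) ⇔ (k₁ ≤ j₁ × (k₂ ≤ j₂ × k₂ ⪯[ b , N ] j₂))
    support-split = mk⇔ to from
      where
      open Equivalence (⪯-split N j₁<b k₁<b j₂<b^N k₂<b^N) renaming (to to ⪯-to; from to ⪯-from)
      to : k ≤ j × k ⪯[ b , suc N ] j → k₁ ≤ j₁ × (k₂ ≤ j₂ × k₂ ⪯[ b , N ] j₂)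
      to (_ , k⪯j) with ⪯-to k⪯j
      ... | k₁≤j₁ , k₂⪯j₂ = k₁≤j₁ , ⪯⇒≤ N k₂<b^N k₂⪯j₂ , k₂⪯j₂
      from : k₁ ≤ j₁ × (k₂ ≤ j₂ × k₂ ⪯[ b , N ] j₂) → k ≤ j × k ⪯[ b , suc N ] j
      from (k₁≤j₁ , k₂≤j₂ , k₂⪯j₂) = +-mono-≤ (*-monoʳ-≤ (b ^ N) k₁≤j₁) k₂≤j₂ , ⪯-from (k₁≤j₁ , k₂⪯j₂)

    digitEntry-split : ∀ σ x → digitEntry σ b (suc N) x j k
                               ≡ ifDec (k₁ ≤? j₁) (σ (j₁ ∸ k₁) (x (fromℕ N))) 0ℚ
                                 * digitEntry σ b N (λ i → x (inject₁ i)) j₂ k₂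
    digitEntry-split σ x = ifDec-zero-* _ (k₁ ≤? j₁) _ support-split product-split
      where
      product-split : k₁ ≤ j₁ × (k₂ ≤ j₂ × k₂ ⪯[ b , N ] j₂) →
                      prodFin (suc N) (λ i → σ (digit b (toℕ i) (j ∸ k)) (x i))
                      ≡ σ (j₁ ∸ k₁) (x (fromℕ N)) * prodFin N (λ i → σ (digit b (toℕ i) (j₂ ∸ k₂)) (x (inject₁ i)))
      product-split (k₁≤j₁ , k₂≤j₂ , _) = begin
        prodFin (suc N) (λ i → σ (digit b (toℕ i) (j ∸ k)) (x i))
          ≡⟨ prodFin-last N (λ i → σ (digit b (toℕ i) (j ∸ k)) (x i)) ⟩
        σ (digit b (toℕ (fromℕ N)) (j ∸ k)) (x (fromℕ N))
          * prodFin N (λ i → σ (digit b (toℕ (inject₁ i)) (j ∸ k)) (x (inject₁ i)))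
          ≡⟨ cong₂ _*_ (cong (λ d → σ d (x (fromℕ N))) top-digit)
                       (prodFin-cong N (λ i → cong (λ d → σ d (x (inject₁ i))) (lower-digit i))) ⟩
        σ (j₁ ∸ k₁) (x (fromℕ N)) * prodFin N (λ i → σ (digit b (toℕ i) (j₂ ∸ k₂)) (x (inject₁ i))) ∎
        where
        open ≡-Reasoning
        j∸k≡ : j ∸ k ≡ b ^ N ℕ.* (j₁ ∸ k₁) ℕ.+ (j₂ ∸ k₂)
        j∸k≡ = [m*n+o]∸[m*p+q]≡m*[n∸p]+[o∸q] (b ^ N) k₁≤j₁ k₂≤j₂
        top-digit : digit b (toℕ (fromℕ N)) (j ∸ k) ≡ j₁ ∸ k₁
        top-digit = trans (cong (digit b (toℕ (fromℕ N))) j∸k≡)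
                          (digit-fromℕ N (≤-<-trans (m∸n≤m j₁ k₁) j₁<b) (≤-<-trans (m∸n≤m j₂ k₂) j₂<b^N))
        lower-digit : ∀ i → digit b (toℕ (inject₁ i)) (j ∸ k) ≡ digit b (toℕ i) (j₂ ∸ k₂)
        lower-digit i = trans (cong (digit b (toℕ (inject₁ i))) j∸k≡) (digit-inject₁ (j₁ ∸ k₁) (j₂ ∸ k₂) i)

toℕ-quotient-remainder : ∀ {m} n (i : Fin (m ℕ.* n)) →
                         toℕ i ≡ n ℕ.* toℕ (quotient {m} n i) ℕ.+ toℕ (remainder {m} n i)
toℕ-quotient-remainder {m} n i =
  trans (cong toℕ (sym (combine-remQuot {m} n i))) (toℕ-combine (quotient {m} n i) (remainder {m} n i))

digitMatrix-suc : ∀ σ b .{{_ : NonZero b}} N (x : Fin (suc N) → ℚ) j k →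
                  digitMatrix σ b (suc N) x j k
                  ≡ (oneDigitMatrix σ b (x (fromℕ N)) ⊗ digitMatrix σ b N (λ i → x (inject₁ i))) j k
digitMatrix-suc σ b N x j k = begin
  digitEntry σ b (suc N) x (toℕ j) (toℕ k)
    ≡⟨ cong₂ (digitEntry σ b (suc N) x) (toℕ-quotient-remainder {b} (b ^ N) j) (toℕ-quotient-remainder {b} (b ^ N) k) ⟩
  digitEntry σ b (suc N) x (b ^ N ℕ.* toℕ j₁ ℕ.+ toℕ j₂) (b ^ N ℕ.* toℕ k₁ ℕ.+ toℕ k₂)
    ≡⟨ Digits.digitEntry-split b N (toℕ<n j₁) (toℕ<n k₁) (toℕ<n j₂) (toℕ<n k₂) σ x ⟩
  (oneDigitMatrix σ b (x (fromℕ N)) ⊗ digitMatrix σ b N (λ i → x (inject₁ i))) j k ∎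
  where
  open ≡-Reasoning
  j₁ k₁ : Fin b
  j₂ k₂ : Fin (b ^ N)
  j₁ = quotient {b} (b ^ N) j
  k₁ = quotient {b} (b ^ N) k
  j₂ = remainder {b} (b ^ N) j
  k₂ = remainder {b} (b ^ N) k

lemma2p3 : (D : ShefferData) (b : ℕ) .{{_ : NonZero b}} → 2 ≤ b → (N : ℕ) →
    (x : Fin (suc N) → ℚ) →
    (∀ j k → SMat D b (suc N) x j k
               ≡ (S1Mat D b (x (fromℕ N)) ⊗ SMat D b N (λ i → x (inject₁ i))) j k)
    × (∀ j k → PMat D b (suc N) x j k
               ≡ (P1Mat D b (x (fromℕ N)) ⊗ PMat D b N (λ i → x (inject₁ i))) j k)
lemma2p3 D b _ N x = digitMatrix-suc (ShefferData.sBar D) b N x , digitMatrix-suc (ShefferData.pBar D) b N x
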